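{- The graphs $\Gamma(9)$ and $\Gamma(18)$ are semisymmetric graphs of order $54$, of valency $9$ and $18$ respectively.
   Context: A graph is semisymmetric if it is regular and edge-transitive but not vertex-transitive. Let $\mathbb V=\mathbb V(3,3)$ be the 3-dimensional vector space over $\mathrm{GF}(3)$ and $\mathbb V_0=\{(0,b,c)\}$, $\mathbb V_1=\{(a,0,c)\}$, $\mathbb V_2=\{(a,b,0)\}$ (entries in $\mathrm{GF}(3)$). $\Sigma(3)$ is the bipartite graph with parts $\mathcal W=\mathbb V$ and $\mathcal U=\{\alpha+\mathbb V_i:\alpha\in\mathbb V,i\in\mathbb Z_3\}$ (nine affine planes), with edge set $\{\{\alpha,\alpha+\mathbb V_i\}:\alpha\in\mathbb V,i\in\mathbb Z_3\}$. $\Sigma(6)$ is its bipartite complement (same parts, $\mathbf w\in\mathcal W$ and $\mathbf u\in\mathcal U$ adjacent iff not adjacent in $\Sigma(3)$). For such a bipartite graph $\Sigma$ with edge set $\mathcal E$, the graph expanded from $\Sigma$ has parts $\mathcal W$ and $\mathcal U\times\mathbb Z_3$ and edge set $\{\{\mathbf w,(\mathbf u,i)\}:\{\mathbf w,\mathbf u\}\in\mathcal E, i\in\mathbb Z_3\}$. $\Gamma(9)$ and $\Gamma(18)$ are the graphs expanded from $\Sigma(3)$ and $\Sigma(6)$ respectively. -}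

module Defs where

open import Data.Nat using (ℕ)
open import Data.Fin using (Fin)
open import Data.Vec using (Vec; lookup)
open import Data.Product using (Σ; ∃; _×_; _,_)
open import Data.Sum using (_⊎_; inj₁; inj₂)
open import Data.Empty using (⊥)
open import Data.Bool using (Bool; T; not)
open import Data.Fin using (_≟_)
open import Relation.Nullary.Decidable using (⌊_⌋)
open import Relation.Nullary using (¬_)
open import Relation.Binary.PropositionalEquality using (_≡_; _≢_)
open import Function.Bundles using (_↔_; _⇔_; Inverse)

record Graph : Set₁ where
  field
    Vtx : Set
    Adj : Vtx → Vtx → Set

open Graph public

record Aut (G : Graph) : Set where
  field
    perm     : Vtx G ↔ Vtx G
    preserve : ∀ x y → Adj G x y ⇔ Adj G (Inverse.to perm x) (Inverse.to perm y)

app : {G : Graph} → Aut G → Vtx G → Vtx G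
app σ = Inverse.to (Aut.perm σ)

HasOrder : ℕ → Graph → Set
HasOrder n G = Fin n ↔ Vtx G

Regular : ℕ → Graph → Set
Regular k G = ∀ v → Fin k ↔ Σ (Vtx G) (Adj G v)

VertexTransitive : Graph → Set
VertexTransitive G = ∀ u v → Σ (Aut G) λ σ → app σ u ≡ v

EdgeTransitive : Graph → Set
EdgeTransitive G =
  ∀ x y x' y' → Adj G x y → Adj G x' y' →
  Σ (Aut G) λ σ → (app σ x ≡ x' × app σ y ≡ y') ⊎ (app σ x ≡ y' × app σ y ≡ x')

Semisymmetric : Graph → Set
Semisymmetric G = (∃ λ k → Regular k G) × EdgeTransitive G × ¬ VertexTransitive G

GF3 : Set
GF3 = Fin 3

𝕍 : Set
𝕍 = Vec GF3 3

-- 𝒰 : the nine affine planes α + 𝕍_i.  Since 𝕍_i = {β : β_i = 0}, the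
-- coset α + 𝕍_i is {β : β_i = α_i}; it is determined by the pair
-- (i , α_i), and distinct pairs give distinct cosets.  So a plane is
-- represented by (i , c), standing for {β : β_i = c}.
𝒰 : Set
𝒰 = Fin 3 × GF3

-- membership of a point in a plane (i , c), decided (Bool-valued, so
-- that adjacency is proof-irrelevant and neighbourhoods can be counted
-- by bijections without function extensionality).
_∈P_ : 𝕍 → 𝒰 → Bool
β ∈P (i , c) = ⌊ lookup β i ≟ c ⌋

Bip : (𝕍 → 𝒰 → Set) → Graph
Bip R = record { Vtx = 𝕍 ⊎ 𝒰 ; Adj = adj }
  where
  adj : 𝕍 ⊎ 𝒰 → 𝕍 ⊎ 𝒰 → Set
  adj (inj₁ w) (inj₂ u) = R w u
  adj (inj₂ u) (inj₁ w) = R w u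
  adj _ _ = ⊥

Σ3-rel : 𝕍 → 𝒰 → Set
Σ3-rel w u = T (w ∈P u)

Σ6-rel : 𝕍 → 𝒰 → Set
Σ6-rel w u = T (not (w ∈P u))

Σ3 : Graph
Σ3 = Bip Σ3-rel

Σ6 : Graph
Σ6 = Bip Σ6-rel

Expand : (𝕍 → 𝒰 → Set) → Graph
Expand R = record { Vtx = 𝕍 ⊎ (𝒰 × Fin 3) ; Adj = adj }
  where
  adj : 𝕍 ⊎ (𝒰 × Fin 3) → 𝕍 ⊎ (𝒰 × Fin 3) → Set
  adj (inj₁ w) (inj₂ (u , _)) = R w u
  adj (inj₂ (u , _)) (inj₁ w) = R w u
  adj _ _ = ⊥

Γ9 : Graph
Γ9 = Expand Σ3-rel

Γ18 : Graph
Γ18 = Expand Σ6-rel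

module Submission where

-- Both graphs are instances of Γ b below, in which a point w is joined to
-- the three copies (u , k) of a coordinate plane u exactly when (w ∈ u) = b.  Permuting the coordinates of
-- V(3,3) and, independently in each coordinate, the elements of GF(3)
-- preserves incidence of points and planes; with the permutations of the
-- copies this group is transitive on the pairs (point , plane copy) with a
-- prescribed incidence, so Γ b is edge-transitive.  It is not
-- vertex-transitive: the copies of a plane are twins (they have the same
-- neighbourhood) while no point has a twin, as distinct points are
-- separated by a coordinate plane, and automorphisms map twins to twins.

open import Data.Bool using (Bool; true; false; T; not; if_then_else_)
open import Data.Empty using (⊥-elim)
open import Data.Fin using (Fin; zero; suc; _≟_; punchIn)
open import Data.Fin.Permutation
  using (Permutation′; _⟨$⟩ʳ_; _⟨$⟩ˡ_; _∘ₚ_; transpose; inverseˡ; inverseʳ)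
open import Data.Fin.Properties
  using (0↔⊥; 1↔⊤; +↔⊎; *↔×; ∃-here; ∃-there; ∃-toSum; all?; punchInᵢ≢i)
open import Data.Nat using (ℕ; zero; suc; _^_)
import Data.Nat.Properties as ℕ
open import Data.Product using (Σ; ∃; _×_; _,_; proj₁; proj₂; map₂; swap; uncurry)
open import Data.Product.Function.Dependent.Propositional using (Σ-↔)
open import Data.Product.Function.NonDependent.Propositional using (_×-↔_)
open import Data.Sum using (_⊎_; inj₁; inj₂; [_,_])
open import Data.Sum.Function.Propositional using (_⊎-↔_)
open import Data.Vec using (Vec; []; _∷_; lookup; tabulate; countᵇ)
open import Data.Vec.Properties using (lookup∘tabulate)
open import Data.Vec.Relation.Binary.Pointwise.Extensional using (ext; Pointwise-≡⇒≡)
open import Function using (_∘_; id)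
open import Function.Bundles using (_↔_; _⇔_; Inverse; Equivalence; Injection; mk↔ₛ′)
open import Function.Construct.Composition using (_⇔-∘_)
open import Function.Construct.Identity using (⇔-id)
open import Function.Construct.Symmetry using (⇔-sym)
open import Function.Properties.Inverse using (↔-refl; ↔-sym; ↔-trans; ↔⇒↣)
open import Relation.Binary.PropositionalEquality
  using (_≡_; _≢_; refl; sym; trans; cong; cong₂; subst; module ≡-Reasoning)
open import Relation.Nullary using (¬_; Dec; yes; no)
open import Relation.Nullary.Decidable
  using (⌊_⌋; dec-true; dec-false; from-yes; toWitness; fromWitness; fromWitnessFalse)

open import Defs

open Inverse using (to; from; strictlyInverseˡ; strictlyInverseʳ)

↔-injective : ∀ {a b} {A : Set a} {B : Set b} (e : A ↔ B) {x y} → to e x ≡ to e y → x ≡ y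
↔-injective e = Injection.injective (↔⇒↣ e)

Vec-suc↔× : ∀ {a} {A : Set a} {n} → (A × Vec A n) ↔ Vec A (suc n)
Vec-suc↔× = mk↔ₛ′ (uncurry _∷_) (λ { (x ∷ xs) → x , xs }) (λ { (_ ∷ _) → refl }) (λ _ → refl)

Fin^↔Vec : ∀ m n → Fin (m ^ n) ↔ Vec (Fin m) n
Fin^↔Vec m zero    = mk↔ₛ′ (λ _ → []) (λ _ → zero) (λ { [] → refl }) (λ { zero → refl })
Fin^↔Vec m (suc n) = ↔-trans (*↔× {m}) (↔-trans (↔-refl ×-↔ Fin^↔Vec m n) Vec-suc↔×)

Twins : (G : Graph) → Vtx G → Vtx G → Set
Twins G x y = ∀ z → Adj G x z ⇔ Adj G y z

Aut-Twins : ∀ {G} (σ : Aut G) {x y} → Twins G x y → Twins G (app σ x) (app σ y)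
Aut-Twins {G} σ {x} {y} twins z =
  subst (λ v → Adj G (app σ x) v ⇔ Adj G (app σ y) v) (strictlyInverseˡ (Aut.perm σ) z)
    (Aut.preserve σ y z′ ⇔-∘ (twins z′ ⇔-∘ ⇔-sym (Aut.preserve σ x z′)))
  where
  z′ = from (Aut.perm σ) z

-- An automorphism moving x to v moves its twin y to a twin of v.
VertexTransitive⇒Twins : ∀ {G} → VertexTransitive G → ∀ {x y} → x ≢ y → Twins G x y →
                         ∀ v → ∃ λ v′ → v ≢ v′ × Twins G v v′
VertexTransitive⇒Twins {G} vt {x} {y} x≢y twins v =
  app σ y , v≢σy , subst (λ u → Twins G u (app σ y)) σx≡v (Aut-Twins σ twins)
  where
  σ = proj₁ (vt x v)
  σx≡v = proj₂ (vt x v)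
  v≢σy : v ≢ app σ y
  v≢σy v≡σy = x≢y (↔-injective (Aut.perm σ) (trans σx≡v v≡σy))

Σ-Fin-suc↔⊎ : ∀ {n} {P : Fin (suc n) → Set} → Σ (Fin (suc n)) P ↔ (P zero ⊎ Σ (Fin n) (P ∘ suc))
Σ-Fin-suc↔⊎ = mk↔ₛ′ ∃-toSum [ ∃-here , ∃-there ]
  (λ { (inj₁ _) → refl ; (inj₂ _) → refl })
  (λ { (zero , _) → refl ; (suc _ , _) → refl })

-- (if b then suc else id) m is the form in which countᵇ unfolds on a cons.
T⊎↔Fin : ∀ b {S : Set} {m} → S ↔ Fin m → (T b ⊎ S) ↔ Fin ((if b then suc else id) m)
T⊎↔Fin true  S↔m = ↔-trans (↔-sym 1↔⊤ ⊎-↔ S↔m) (↔-sym (+↔⊎ {1}))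
T⊎↔Fin false S↔m = ↔-trans (↔-sym 0↔⊥ ⊎-↔ S↔m) (↔-sym (+↔⊎ {0}))

countᵇ-tabulate↔ : ∀ {a} {A : Set a} {n} (p : A → Bool) (f : Fin n → A) →
                   Σ (Fin n) (λ i → T (p (f i))) ↔ Fin (countᵇ p (tabulate f))
countᵇ-tabulate↔ {n = zero}  p f = mk↔ₛ′ (λ ()) (λ ()) (λ ()) (λ ())
countᵇ-tabulate↔ {n = suc n} p f =
  ↔-trans Σ-Fin-suc↔⊎ (T⊎↔Fin (p (f zero)) (countᵇ-tabulate↔ p (f ∘ suc)))

Regular-byCount : ∀ {n k} (G : Graph) (e : Fin n ↔ Vtx G) (adj : Vtx G → Vtx G → Bool) →
                  (∀ x y → Adj G x y ↔ T (adj x y)) →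
                  (∀ j → countᵇ (adj (to e j)) (tabulate (to e)) ≡ k) → Regular k G
Regular-byCount {k = k} G e adj Adj↔ degree v =
  ↔-sym (↔-trans (Σ-↔ ↔-refl (Adj↔ v _))
        (↔-trans (↔-sym (Σ-↔ e ↔-refl))
        (subst (λ m → _ ↔ Fin m) degree-v (countᵇ-tabulate↔ (adj v) (to e)))))
  where
  degree-v : countᵇ (adj v) (tabulate (to e)) ≡ k
  degree-v = subst (λ u → countᵇ (adj u) (tabulate (to e)) ≡ k)
                   (strictlyInverseˡ e v) (degree (from e v))

-- x ≐ b is true iff x ≡ b.  It is defined by cases on b rather than as
-- ⌊ x Bool.≟ b ⌋ so that x ≐ true and x ≐ false compute to x and not x.
infix 4 _≐_
_≐_ : Bool → Bool → Bool
x ≐ true  = x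
x ≐ false = not x

≐⇒≡ : ∀ x b → T (x ≐ b) → x ≡ b
≐⇒≡ true  true  _ = refl
≐⇒≡ false false _ = refl

≐-injective : ∀ x y b → (T (x ≐ b) ⇔ T (y ≐ b)) → x ≡ y
≐-injective true  true  _     _ = refl
≐-injective false false _     _ = refl
≐-injective true  false true  e = ⊥-elim (Equivalence.to e _)
≐-injective true  false false e = ⊥-elim (Equivalence.from e _)
≐-injective false true  true  e = ⊥-elim (Equivalence.from e _)
≐-injective false true  false e = ⊥-elim (Equivalence.to e _)

∃-≟≐ : ∀ {n} (a : Fin (suc (suc n))) b → ∃ λ c → T (⌊ a ≟ c ⌋ ≐ b)
∃-≟≐ a true  = a , fromWitness refl
∃-≟≐ a false = punchIn a zero , fromWitnessFalse (punchInᵢ≢i a zero ∘ sym)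

≟-diag⇒≡ : ∀ {n} {a c : Fin n} → ⌊ a ≟ c ⌋ ≡ ⌊ c ≟ c ⌋ → a ≡ c
≟-diag⇒≡ e = toWitness (subst T (sym e) (fromWitness refl))

transpose-matchˡ : ∀ {n} (i j : Fin n) → transpose i j ⟨$⟩ʳ i ≡ j
transpose-matchˡ i j rewrite dec-true (i ≟ i) refl = refl

transpose-fixes : ∀ {n} {i j k : Fin n} → k ≢ i → k ≢ j → transpose i j ⟨$⟩ʳ k ≡ k
transpose-fixes {i = i} {j} {k} k≢i k≢j
  rewrite dec-false (k ≟ i) k≢i | dec-false (k ≟ j) k≢j = refl

permutation-≟ : ∀ {n} (π : Permutation′ n) a c → ⌊ π ⟨$⟩ʳ a ≟ π ⟨$⟩ʳ c ⌋ ≡ ⌊ a ≟ c ⌋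
permutation-≟ π a c with π ⟨$⟩ʳ a ≟ π ⟨$⟩ʳ c | a ≟ c
... | yes _  | yes _    = refl
... | no  _  | no  _    = refl
... | yes πa≡πc | no a≢c = ⊥-elim (a≢c (↔-injective π πa≡πc))
... | no πa≢πc  | yes a≡c = ⊥-elim (πa≢πc (cong (π ⟨$⟩ʳ_) a≡c))

-- For a ≢ c: after the transposition (a b), c has moved to some c′ ≢ b,
-- and the transposition (c′ d) then fixes b.
permutation-mapping-pair : ∀ {n} {a b c d : Fin n} → ⌊ a ≟ c ⌋ ≡ ⌊ b ≟ d ⌋ →
                           ∃ λ (π : Permutation′ n) → π ⟨$⟩ʳ a ≡ b × π ⟨$⟩ʳ c ≡ d
permutation-mapping-pair {a = a} {b} {c} {d} same with a ≟ c | b ≟ d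
... | yes refl | yes refl = transpose a b , transpose-matchˡ a b , transpose-matchˡ a b
... | no a≢c   | no b≢d   =
  transpose a b ∘ₚ transpose c′ d ,
  trans (cong (transpose c′ d ⟨$⟩ʳ_) (transpose-matchˡ a b)) (transpose-fixes b≢c′ b≢d) ,
  transpose-matchˡ c′ d
  where
  c′ = transpose a b ⟨$⟩ʳ c
  b≢c′ : b ≢ c′
  b≢c′ b≡c′ = a≢c (↔-injective (transpose a b) (trans (transpose-matchˡ a b) b≡c′))
permutation-mapping-pair () | yes _ | no _
permutation-mapping-pair () | no _  | yes _

module _ {a} {A : Set a} {n : ℕ} (π : Permutation′ n) (f : Fin n → A ↔ A) where

  wreathMap : Vec A n → Vec A n
  wreathMap w = tabulate λ j → to (f (π ⟨$⟩ˡ j)) (lookup w (π ⟨$⟩ˡ j))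

  lookup-wreathMap : ∀ w i → lookup (wreathMap w) (π ⟨$⟩ʳ i) ≡ to (f i) (lookup w i)
  lookup-wreathMap w i =
    trans (lookup∘tabulate _ (π ⟨$⟩ʳ i)) (cong (λ k → to (f k) (lookup w k)) (inverseˡ π))

  wreathMap-≡ : ∀ {w w′} → (∀ i → to (f i) (lookup w i) ≡ lookup w′ (π ⟨$⟩ʳ i)) →
                wreathMap w ≡ w′
  wreathMap-≡ {w} {w′} hyp = Pointwise-≡⇒≡ (ext λ j → begin
    lookup (wreathMap w) j                      ≡⟨ lookup∘tabulate _ j ⟩
    to (f (π ⟨$⟩ˡ j)) (lookup w (π ⟨$⟩ˡ j))     ≡⟨ hyp (π ⟨$⟩ˡ j) ⟩
    lookup w′ (π ⟨$⟩ʳ (π ⟨$⟩ˡ j))               ≡⟨ cong (lookup w′) (inverseʳ π) ⟩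
    lookup w′ j                                 ∎)
    where open ≡-Reasoning

  wreath : Vec A n ↔ Vec A n
  wreath = mk↔ₛ′ wreathMap unmap
    (λ w → wreathMap-≡ {unmap w} λ i → trans (cong (to (f i)) (lookup∘tabulate _ i))
                                   (strictlyInverseˡ (f i) _))
    (λ w → Pointwise-≡⇒≡ (ext λ i → trans (lookup∘tabulate _ i)
             (trans (cong (from (f i)) (lookup-wreathMap w i)) (strictlyInverseʳ (f i) _))))
    where
    unmap : Vec A n → Vec A n
    unmap w = tabulate λ i → from (f i) (lookup w (π ⟨$⟩ʳ i))

  wreathPlanes : (Fin n × A) ↔ (Fin n × A)
  wreathPlanes = mk↔ₛ′ (λ (i , c) → π ⟨$⟩ʳ i , to (f i) c) unmap
    (λ (j , d) → cong₂ _,_ (inverseʳ π) (strictlyInverseˡ (f (π ⟨$⟩ˡ j)) d))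
    unmap∘map
    where
    unmap : Fin n × A → Fin n × A
    unmap (j , d) = π ⟨$⟩ˡ j , from (f (π ⟨$⟩ˡ j)) d
    unmap∘map : ∀ ic → unmap (π ⟨$⟩ʳ proj₁ ic , to (f (proj₁ ic)) (proj₂ ic)) ≡ ic
    unmap∘map (i , c) rewrite inverseˡ π {i} = cong (i ,_) (strictlyInverseʳ (f i) c)

∈P-wreath : (π : Permutation′ 3) (f : Fin 3 → Permutation′ 3) → ∀ w u →
            to (wreath π f) w ∈P to (wreathPlanes π f) u ≡ w ∈P u
∈P-wreath π f w (i , c) = begin
  ⌊ lookup (wreathMap π f w) (π ⟨$⟩ʳ i) ≟ f i ⟨$⟩ʳ c ⌋  ≡⟨ cong (λ x → ⌊ x ≟ _ ⌋) (lookup-wreathMap π f w i) ⟩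
  ⌊ f i ⟨$⟩ʳ lookup w i ≟ f i ⟨$⟩ʳ c ⌋                 ≡⟨ permutation-≟ (f i) _ _ ⟩
  ⌊ lookup w i ≟ c ⌋                                    ∎
  where open ≡-Reasoning

module _ {R : 𝕍 → 𝒰 → Set} where

  Expand-aut : (φ : 𝕍 ↔ 𝕍) (ψ : 𝒰 ↔ 𝒰) (τ : Permutation′ 3) →
               (∀ w u → R w u ⇔ R (to φ w) (to ψ u)) → Aut (Expand R)
  Expand-aut φ ψ τ pres = record { perm = perm ; preserve = preserve }
    where
    perm = φ ⊎-↔ (ψ ×-↔ τ)
    preserve : ∀ x y → Adj (Expand R) x y ⇔ Adj (Expand R) (to perm x) (to perm y)
    preserve (inj₁ w)       (inj₂ (u , _)) = pres w u
    preserve (inj₂ (u , _)) (inj₁ w)       = pres w u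
    preserve (inj₁ _)       (inj₁ _)       = ⇔-id _
    preserve (inj₂ _)       (inj₂ _)       = ⇔-id _

  Expand-edgeTransitive :
    (∀ w u k w′ u′ k′ → R w u → R w′ u′ → Σ (Aut (Expand R)) λ σ →
       app σ (inj₁ w) ≡ inj₁ w′ × app σ (inj₂ (u , k)) ≡ inj₂ (u′ , k′)) →
    EdgeTransitive (Expand R)
  Expand-edgeTransitive flags (inj₁ w) (inj₂ (u , k)) (inj₁ w′) (inj₂ (u′ , k′)) e e′ =
    map₂ inj₁ (flags w u k w′ u′ k′ e e′)
  Expand-edgeTransitive flags (inj₁ w) (inj₂ (u , k)) (inj₂ (u′ , k′)) (inj₁ w′) e e′ =
    map₂ inj₂ (flags w u k w′ u′ k′ e e′)
  Expand-edgeTransitive flags (inj₂ (u , k)) (inj₁ w) (inj₁ w′) (inj₂ (u′ , k′)) e e′ =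
    map₂ (inj₂ ∘ swap) (flags w u k w′ u′ k′ e e′)
  Expand-edgeTransitive flags (inj₂ (u , k)) (inj₁ w) (inj₂ (u′ , k′)) (inj₁ w′) e e′ =
    map₂ (inj₁ ∘ swap) (flags w u k w′ u′ k′ e e′)
  Expand-edgeTransitive flags (inj₁ _) (inj₁ _) _ _ () _
  Expand-edgeTransitive flags (inj₂ _) (inj₂ _) _ _ () _
  Expand-edgeTransitive flags (inj₁ _) (inj₂ _) (inj₁ _) (inj₁ _) _ ()
  Expand-edgeTransitive flags (inj₁ _) (inj₂ _) (inj₂ _) (inj₂ _) _ ()
  Expand-edgeTransitive flags (inj₂ _) (inj₁ _) (inj₁ _) (inj₁ _) _ ()
  Expand-edgeTransitive flags (inj₂ _) (inj₁ _) (inj₂ _) (inj₂ _) _ ()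

  Expand-copies-twins : ∀ u k k′ → Twins (Expand R) (inj₂ (u , k)) (inj₂ (u , k′))
  Expand-copies-twins u k k′ (inj₁ _) = ⇔-id _
  Expand-copies-twins u k k′ (inj₂ _) = ⇔-id _

-- Γ true is Γ(9) and Γ false is Γ(18), definitionally.
Γ : Bool → Graph
Γ b = Expand λ w u → T (w ∈P u ≐ b)

Γ-wreathAut : ∀ b → Permutation′ 3 → (Fin 3 → Permutation′ 3) → Permutation′ 3 → Aut (Γ b)
Γ-wreathAut b π f τ = Expand-aut (wreath π f) (wreathPlanes π f) τ preserves
  where
  preserves : ∀ w u → T (w ∈P u ≐ b) ⇔ T (to (wreath π f) w ∈P to (wreathPlanes π f) u ≐ b)
  preserves w u rewrite ∈P-wreath π f w u = ⇔-id _

-- Send i to i′ by the coordinate permutation; in coordinate i use a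
-- permutation of GF(3) sending (w i , c) to (w′ i′ , c′), which exists
-- because both pairs are equal or both are distinct; in every other
-- coordinate j just send w j to w′ (π j).
Γ-flags : ∀ b w i c k w′ i′ c′ k′ → T (w ∈P (i , c) ≐ b) → T (w′ ∈P (i′ , c′) ≐ b) →
          Σ (Aut (Γ b)) λ σ → app σ (inj₁ w) ≡ inj₁ w′ × app σ (inj₂ ((i , c) , k)) ≡ inj₂ ((i′ , c′) , k′)
Γ-flags b w i c k w′ i′ c′ k′ inc inc′ =
  Γ-wreathAut b π f (transpose k k′) ,
  cong inj₁ (wreathMap-≡ π f {w} f-point) ,
  cong inj₂ (cong₂ _,_ (cong₂ _,_ (transpose-matchˡ i i′) f-plane) (transpose-matchˡ k k′))
  where
  π = transpose i i′
  ρ : ∃ λ (ρ : Permutation′ 3) → ρ ⟨$⟩ʳ lookup w i ≡ lookup w′ i′ × ρ ⟨$⟩ʳ c ≡ c′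
  ρ = permutation-mapping-pair (trans (≐⇒≡ _ b inc) (sym (≐⇒≡ _ b inc′)))
  coordinatePerm : ∀ j → Dec (j ≡ i) → Permutation′ 3
  coordinatePerm j (yes _) = proj₁ ρ
  coordinatePerm j (no _)  = transpose (lookup w j) (lookup w′ (π ⟨$⟩ʳ j))
  f : Fin 3 → Permutation′ 3
  f j = coordinatePerm j (j ≟ i)
  coordinatePerm-point : ∀ j j≟i → coordinatePerm j j≟i ⟨$⟩ʳ lookup w j ≡ lookup w′ (π ⟨$⟩ʳ j)
  coordinatePerm-point j (yes refl) =
    trans (proj₁ (proj₂ ρ)) (cong (lookup w′) (sym (transpose-matchˡ i i′)))
  coordinatePerm-point j (no _) = transpose-matchˡ (lookup w j) _
  f-point : ∀ j → f j ⟨$⟩ʳ lookup w j ≡ lookup w′ (π ⟨$⟩ʳ j)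
  f-point j = coordinatePerm-point j (j ≟ i)
  f-plane : f i ⟨$⟩ʳ c ≡ c′
  f-plane with i ≟ i
  ... | yes _   = proj₂ (proj₂ ρ)
  ... | no  i≢i = ⊥-elim (i≢i refl)

Γ-edgeTransitive : ∀ b → EdgeTransitive (Γ b)
Γ-edgeTransitive b = Expand-edgeTransitive λ w (i , c) k w′ (i′ , c′) k′ → Γ-flags b w i c k w′ i′ c′ k′

-- Another point w′ differs from w in some coordinate i, so exactly one
-- of w and w′ lies on the plane (i , w′ i).
Γ-point-twinFree : ∀ b w v → Twins (Γ b) (inj₁ w) v → inj₁ w ≡ v
Γ-point-twinFree b w (inj₂ _) twins =
  ⊥-elim (Equivalence.to (twins (inj₂ ((zero , c) , zero))) incident)
  where
  c = proj₁ (∃-≟≐ (lookup w zero) b)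
  incident = proj₂ (∃-≟≐ (lookup w zero) b)
Γ-point-twinFree b w (inj₁ w′) twins = cong inj₁ (Pointwise-≡⇒≡ (ext λ i →
  ≟-diag⇒≡ (≐-injective _ _ b (twins (inj₂ ((i , lookup w′ i) , zero))))))

Γ-not-vertexTransitive : ∀ b → ¬ VertexTransitive (Γ b)
Γ-not-vertexTransitive b vt = w₀≢v (Γ-point-twinFree b w₀ v twins)
  where
  w₀ : 𝕍
  w₀ = zero ∷ zero ∷ zero ∷ []
  x y : Vtx (Γ b)
  x = inj₂ ((zero , zero) , zero)
  y = inj₂ ((zero , zero) , suc zero)
  twin = VertexTransitive⇒Twins vt {x} {y} (λ ()) (Expand-copies-twins _ _ _) (inj₁ w₀)
  v = proj₁ twin
  w₀≢v = proj₁ (proj₂ twin)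
  twins = proj₂ (proj₂ twin)

Γ-order : ∀ b → HasOrder 54 (Γ b)
Γ-order b = ↔-trans (+↔⊎ {27}) (Fin^↔Vec 3 3 ⊎-↔ ↔-trans (*↔× {9}) (*↔× ×-↔ ↔-refl))

Γ-adj : ∀ b → Vtx (Γ b) → Vtx (Γ b) → Bool
Γ-adj b (inj₁ w)       (inj₂ (u , _)) = w ∈P u ≐ b
Γ-adj b (inj₂ (u , _)) (inj₁ w)       = w ∈P u ≐ b
Γ-adj b _              _              = false

Γ-Adj↔ : ∀ b x y → Adj (Γ b) x y ↔ T (Γ-adj b x y)
Γ-Adj↔ b (inj₁ _) (inj₁ _) = ↔-refl
Γ-Adj↔ b (inj₁ _) (inj₂ _) = ↔-refl
Γ-Adj↔ b (inj₂ _) (inj₁ _) = ↔-refl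
Γ-Adj↔ b (inj₂ _) (inj₂ _) = ↔-refl

Γ-degree : Bool → Fin 54 → ℕ
Γ-degree b j = countᵇ (Γ-adj b (to (Γ-order b) j)) (tabulate (to (Γ-order b)))

valency : Bool → ℕ
valency true  = 9
valency false = 18

Γ-regular : ∀ b → Regular (valency b) (Γ b)
Γ-regular b = Regular-byCount (Γ b) (Γ-order b) (Γ-adj b) (Γ-Adj↔ b) (degrees b)
  where
  degrees : ∀ b j → Γ-degree b j ≡ valency b
  degrees true  = from-yes (all? λ j → Γ-degree true j ℕ.≟ 9)
  degrees false = from-yes (all? λ j → Γ-degree false j ℕ.≟ 18)

Γ-semisymmetric : ∀ b → Semisymmetric (Γ b)
Γ-semisymmetric b = (valency b , Γ-regular b) , Γ-edgeTransitive b , Γ-not-vertexTransitive b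

lemma1p2 : (Semisymmetric Γ9 × HasOrder 54 Γ9 × Regular 9 Γ9)
           × (Semisymmetric Γ18 × HasOrder 54 Γ18 × Regular 18 Γ18)
lemma1p2 = (Γ-semisymmetric true  , Γ-order true  , Γ-regular true)
         , (Γ-semisymmetric false , Γ-order false , Γ-regular false)
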